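{- Let $\mathit{Prog}$ be any CLP program (in the setting described in the context, containing the nullary predicate $\mathtt{unsafe}$). Then the NLR strategy applied to $\mathit{Prog}$ terminates and produces a CLP program $\mathit{Prog}'$ such that $\mathtt{unsafe} \in \mathcal{M}(\mathit{Prog})$ if and only if $\mathtt{unsafe} \in \mathcal{M}(\mathit{Prog}')$.
   Context: A CLP program (set of constrained Horn clauses) is a finite set of clauses $\mathtt{H \,\text{:- }\, c, B_1,\dots,B_m}$, where $\mathtt{H}$ and the $\mathtt{B_i}$ are atoms and $\mathtt{c}$ is a constraint, i.e. a conjunction of atomic constraints in the theory $\mathcal{A}$ of linear integer arithmetic with integer arrays. $\mathcal{M}(P)$ denotes the least model of the program $P$; $\mathtt{unsafe}$ is a nullary predicate. Tuples of variables are identified with the sets of variables occurring in them; the union of two tuples is formed by erasing duplicates. Linking variables: for a clause $C$ of the form $\mathtt{H \,\text{:- }\, c, L, B, R}$, with $\mathtt{c}$ a constraint, $\mathtt{L},\mathtt{R}$ (possibly empty) conjunctions of atoms and $\mathtt{B}$ an atom, the linking variables of $\mathtt{B}$ in $C$ are $\mathit{linkvars}(\mathtt{B},C)=\mathit{vars}(\mathtt{B})\cap \mathit{vars}(\{\mathtt{H},\mathtt{c},\mathtt{L},\mathtt{R}\})$; the others variables of $\mathtt{B}$ are non-linking. The NLR (Non-Linking variable Removal) strategy is a goal-directed application of the unfold/fold transformation rules (unfolding, definition introduction, folding) starting from the predicate $\mathtt{unsafe}$. It maintains a set $\mathit{Defs}$ of definition clauses, each of the form $\mathtt{newp(V) \,\text{:-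 }\, B}$ with $\mathtt{newp}$ a fresh predicate symbol and $\mathtt{B}$ an atom of $\mathit{Prog}$. Every definition clause in $\mathit{Defs}$ is unfolded with respect to the leftmost atom in its body (replacing that atom by the bodies of the matching clauses of $\mathit{Prog}$), producing a set $S$ of clauses; every clause in $S$ (and, initially, the clauses for $\mathtt{unsafe}$) is then folded with respect to all atoms in its body, using definitions in $\mathit{Defs}$ or new ones. When a clause $C=\mathtt{H \,\text{:- }\, c, L, B, R}$, where the predicate of $\mathtt{B}$ occurs in $\mathit{Prog}$, cannot be folded w.r.t. $\mathtt{B}$ using $\mathit{Defs}$, a new definition is introduced as follows: let $F$ be $\mathtt{newp(V)\,\text{:- }\,B}$ with $\mathtt{newp}$ fresh and $\mathtt{V}=\mathit{linkvars}(\mathtt{B},C)$. If $\mathit{Defs}$ contains a clause $D$ of the form $\mathtt{newq(Q) \,\text{:- }\, S}$ with $\mathtt{B}\vartheta=\mathtt{S}$ for some renaming substitution $\vartheta$, then $D$ is replaced in $\mathit{Defs}$ by $\mathtt{newp(L)\,\text{:- }\,B}$ where $\mathtt{L}=\mathtt{V}\vartheta\cup\mathtt{Q}$ (merging definitions with the same body atom up to renaming, taking the union of head variables); otherwise $F$ is added to $\mathit{Defs}$. The strategy stops when all clauses in $\mathit{Defs}$ have been unfolded and no new definition is needed for folding; the output $\mathit{Prog}'$ is the set of folded clauses so obtained. -}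

module Defs where

open import Data.Nat using (ℕ; _+_; _⊔_; suc)
import Data.Nat.Properties as ℕP
open import Data.Integer using (ℤ; _≤_; _<_; _*_) renaming (_+_ to _+ℤ_)
open import Data.Integer as ℤ using (0ℤ; 1ℤ)
import Data.Integer.Properties as ℤP
open import Data.Bool using (if_then_else_)
open import Data.Product using (Σ; ∃; _×_; _,_; proj₁; proj₂)
open import Data.Product.Properties using (≡-dec)
open import Data.List using (List; []; _∷_; _++_; [_]; map; filter; concatMap; foldr; deduplicate)
open import Data.List.Relation.Unary.All using (All)
open import Data.List.Relation.Unary.Any using (_∷=_)
open import Data.List.Relation.Binary.Pointwise using (Pointwise)
open import Data.List.Membership.Propositional using (_∈_; _∉_)
open import Data.List.Relation.Binary.Subset.Propositional using (_⊆_)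
open import Data.List.Membership.DecPropositional using () renaming (_∈?_ to mem?)
open import Relation.Binary.PropositionalEquality using (_≡_; _≢_; refl)
open import Relation.Binary.Construct.Closure.ReflexiveTransitive using (Star)
open import Relation.Nullary using (¬_; Dec; yes; no)
open import Relation.Nullary.Decidable using (⌊_⌋)
open import Relation.Binary.Definitions using (DecidableEquality)

data Sort : Set where
  int arr : Sort

_≟S_ : DecidableEquality Sort
int ≟S int = yes refl
int ≟S arr = no λ ()
arr ≟S int = no λ ()
arr ≟S arr = yes refl

Var : Set
Var = Sort × ℕ

_≟V_ : DecidableEquality Var
_≟V_ = ≡-dec _≟S_ ℕP._≟_

Val : Sort → Set
Val int = ℤ
Val arr = ℤ → ℤ

EqV : (s : Sort) → Val s → Val s → Set
EqV int a b = a ≡ b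
EqV arr a b = ∀ i → a i ≡ b i

data Term : Sort → Set where
  var : (s : Sort) → ℕ → Term s
  cst : ℤ → Term int
  _⊕_ : Term int → Term int → Term int
  _⊙_ : ℤ → Term int → Term int
  rd  : Term arr → Term int → Term int
  wr  : Term arr → Term int → Term int → Term arr

data ACons : Set where
  eqc : (s : Sort) → Term s → Term s → ACons
  lec : Term int → Term int → ACons
  ltc : Term int → Term int → ACons

Constr : Set
Constr = List ACons

falsec : ACons
falsec = lec (cst 1ℤ) (cst 0ℤ)

Valuation : Set
Valuation = (x : Var) → Val (proj₁ x)

eval : ∀ {s} → Valuation → Term s → Val s
eval σ (var s n)  = σ (s , n)
eval σ (cst z)    = z
eval σ (t ⊕ u)    = eval σ t +ℤ eval σ u
eval σ (k ⊙ t)    = k * eval σ t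
eval σ (rd a i)   = eval σ a (eval σ i)
eval σ (wr a i v) = λ j → if ⌊ j ℤP.≟ eval σ i ⌋ then eval σ v else eval σ a j

SatA : Valuation → ACons → Set
SatA σ (eqc s t u) = EqV s (eval σ t) (eval σ u)
SatA σ (lec t u)   = eval σ t ≤ eval σ u
SatA σ (ltc t u)   = eval σ t < eval σ u

Sat : Valuation → Constr → Set
Sat σ c = All (SatA σ) c

varsT : ∀ {s} → Term s → List Var
varsT (var s n)  = (s , n) ∷ []
varsT (cst _)    = []
varsT (t ⊕ u)    = varsT t ++ varsT u
varsT (_ ⊙ t)    = varsT t
varsT (rd a i)   = varsT a ++ varsT i
varsT (wr a i v) = varsT a ++ varsT i ++ varsT v

varsAC : ACons → List Var
varsAC (eqc _ t u) = varsT t ++ varsT u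
varsAC (lec t u)   = varsT t ++ varsT u
varsAC (ltc t u)   = varsT t ++ varsT u

varsC : Constr → List Var
varsC = concatMap varsAC

record Atom : Set where
  constructor atom
  field
    pred : ℕ
    args : List Var
open Atom public

record Clause : Set where
  constructor clause
  field
    hd  : Atom
    con : Constr
    bd  : List Atom
open Clause public

Program : Set
Program = List Clause

unsafeP : ℕ
unsafeP = 0

UnsafeNullary : Program → Set
UnsafeNullary P = ∀ {C A} → C ∈ P → A ∈ (hd C ∷ bd C) → pred A ≡ unsafeP → args A ≡ []

GVal : Set
GVal = Σ Sort Val

GAtom : Set
GAtom = ℕ × List GVal

data GEq : GVal → GVal → Set where
  geq : ∀ {s a b} → EqV s a b → GEq (s , a) (s , b)

inst : Valuation → Atom → GAtom
inst σ (atom p xs) = p , map (λ x → proj₁ x , σ x) xs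

-- least model M(P) (ground atoms taken up to equality in the theory A)
data M (P : Program) : GAtom → Set where
  rule : ∀ {C σ vs} → C ∈ P → Sat σ (con C) →
         All (λ B → M P (inst σ B)) (bd C) →
         Pointwise GEq (proj₂ (inst σ (hd C))) vs →
         M P (pred (hd C) , vs)

unsafeG : GAtom
unsafeG = unsafeP , []

Ren : Set
Ren = Sort → ℕ → ℕ

Injective : Ren → Set
Injective ρ = ∀ s m n → ρ s m ≡ ρ s n → m ≡ n

renV : Ren → Var → Var
renV ρ (s , n) = s , ρ s n

renT : ∀ {s} → Ren → Term s → Term s
renT ρ (var s n)  = var s (ρ s n)
renT ρ (cst z)    = cst z
renT ρ (t ⊕ u)    = renT ρ t ⊕ renT ρ u
renT ρ (k ⊙ t)    = k ⊙ renT ρ t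
renT ρ (rd a i)   = rd (renT ρ a) (renT ρ i)
renT ρ (wr a i v) = wr (renT ρ a) (renT ρ i) (renT ρ v)

renAC : Ren → ACons → ACons
renAC ρ (eqc s t u) = eqc s (renT ρ t) (renT ρ u)
renAC ρ (lec t u)   = lec (renT ρ t) (renT ρ u)
renAC ρ (ltc t u)   = ltc (renT ρ t) (renT ρ u)

renA : Ren → Atom → Atom
renA ρ (atom p xs) = atom p (map (renV ρ) xs)

renCl : Ren → Clause → Clause
renCl ρ (clause h c b) = clause (renA ρ h) (map (renAC ρ) c) (map (renA ρ) b)

Variant : Atom → Atom → Set
Variant A A' = ∃ λ ρ → Injective ρ × renA ρ A ≡ A'

record DefCl : Set where
  constructor defcl
  field
    newp  : ℕ
    hvars : List Var
    body  : Atom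
open DefCl public

Defs : Set
Defs = List DefCl

eqVar : Var → Var → ACons
eqVar (int , m) (int , n) = eqc int (var int m) (var int n)
eqVar (arr , m) (arr , n) = eqc arr (var arr m) (var arr n)
eqVar _ _ = falsec

eqArgs : List Var → List Var → Constr
eqArgs [] [] = []
eqArgs (x ∷ xs) (y ∷ ys) = eqVar x y ∷ eqArgs xs ys
eqArgs _ _ = falsec ∷ []

maxVar : List Var → ℕ
maxVar = foldr (λ x m → proj₂ x ⊔ m) 0

-- renaming apart: shift all variable indices by k
shift : ℕ → Ren
shift k _ n = n + k

unfoldDef : Program → DefCl → List Clause
unfoldDef P D =
  map (λ K → let K' = renCl (shift k) K in
             clause (atom (newp D) (hvars D))
                    (eqArgs (args (body D)) (args (hd K')) ++ con K')
                    (bd K'))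
      (filter (λ K → pred (hd K) ℕP.≟ pred (body D)) P)
  where k = suc (maxVar (hvars D ++ args (body D)))

-- the clauses to be folded: the clauses for unsafe and the unfolded definitions
Cls : Program → Defs → List Clause
Cls P Δ = filter (λ K → pred (hd K) ℕP.≟ unsafeP) P ++ concatMap (unfoldDef P) Δ

linkvars : Atom → Constr → List Atom → Atom → List Atom → List Var
linkvars H c L B R =
  deduplicate _≟V_
    (filter (λ x → mem? _≟V_ x (args H ++ varsC c ++ concatMap args (L ++ R))) (args B))

Foldable : Defs → List Var → Atom → Set
Foldable Δ V B = ∃ λ D → D ∈ Δ × (∃ λ ρ → Injective ρ × renA ρ (body D) ≡ B × V ⊆ map (renV ρ) (hvars D))

FoldAtom : Defs → List Var → Atom → Atom → Set
FoldAtom Δ V B A = ∃ λ D → D ∈ Δ × (∃ λ ρ → Injective ρ × renA ρ (body D) ≡ B × V ⊆ map (renV ρ) (hvars D)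
                                    × A ≡ atom (newp D) (map (renV ρ) (hvars D)))

preds : Program → List ℕ
preds P = concatMap (λ C → map pred (hd C ∷ bd C)) P

Fresh : Program → Defs → ℕ → Set
Fresh P Δ n = n ≢ unsafeP × n ∉ preds P × n ∉ map newp Δ

data Step (P : Program) (Δ : Defs) : Defs → Set where
  add : ∀ {C L B R n} → C ∈ Cls P Δ → bd C ≡ L ++ B ∷ R →
        ¬ Foldable Δ (linkvars (hd C) (con C) L B R) B →
        ¬ (∃ λ D → D ∈ Δ × Variant B (body D)) →
        Fresh P Δ n →
        Step P Δ (Δ ++ [ defcl n (linkvars (hd C) (con C) L B R) B ])
  merge : ∀ {C L B R n D} → C ∈ Cls P Δ → bd C ≡ L ++ B ∷ R →
          ¬ Foldable Δ (linkvars (hd C) (con C) L B R) B →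
          (d : D ∈ Δ) → (ϑ : Ren) → Injective ϑ → renA ϑ B ≡ body D →
          Fresh P Δ n →
          Step P Δ (d ∷= defcl n (deduplicate _≟V_ (hvars D ++ map (renV ϑ) (linkvars (hd C) (con C) L B R))) (body D))

Reach : Program → Defs → Set
Reach P Δ = Star (Step P) [] Δ

Final : Program → Defs → Set
Final P Δ = ∀ {C L B R} → C ∈ Cls P Δ → bd C ≡ L ++ B ∷ R →
            Foldable Δ (linkvars (hd C) (con C) L B R) B

-- folding all body atoms of H :- c, L, Bs  (L = atoms already processed)
data FoldBody (Δ : Defs) (H : Atom) (c : Constr) : List Atom → List Atom → List Atom → Set where
  []  : ∀ {L} → FoldBody Δ H c L [] []
  _∷_ : ∀ {L B R A R'} → FoldAtom Δ (linkvars H c L B R) B A →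
        FoldBody Δ H c (L ++ [ B ]) R R' → FoldBody Δ H c L (B ∷ R) (A ∷ R')

FoldedFrom : Defs → Clause → Clause → Set
FoldedFrom Δ C C' = hd C' ≡ hd C × con C' ≡ con C × FoldBody Δ (hd C) (con C) [] (bd C) (bd C')

Output : Program → Defs → Program → Set
Output P Δ P' = Pointwise (FoldedFrom Δ) (Cls P Δ) P'

-- Termination: a step either adds a definition whose body is a variant of a
-- program atom that no earlier definition body was a variant of (the atoms to
-- be folded are renamings of program atoms), or merges into an existing
-- definition, whose head then gains a body variable it lacked (otherwise the
-- clause would have been foldable).  So the number of uncovered program atoms,
-- followed by the number of body variables missing from definition heads,
-- decreases lexicographically.  Progress holds because foldability is decidable.
-- Correctness: a fact of the folded program for newp D is an instance of the
-- head of D whose body holds in P; the variables hidden by folding are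
-- non-linking, so they can be re-chosen from that instance without disturbing
-- the rest of the clause.  Conversely every derivation in P is replayed through
-- the unfolded and folded clauses.

module Submission where

open import Defs
open import Data.Product using (_×_; ∃; _,_; proj₁; proj₂; uncurry)
open import Data.Product.Relation.Binary.Lex.Strict using (×-Lex; ×-wellFounded)
open import Data.Sum using (_⊎_; inj₁; inj₂; swap)
open import Data.List using (List; []; _∷_; _++_; [_]; map; filter; concatMap; foldr; deduplicate; length; zip)
open import Data.Nat.ListAction using (sum)
open import Data.List.Relation.Unary.Any using (here; there; _∷=_)
open import Data.List.Relation.Unary.All using (All; []; _∷_; all?; lookup; tabulate)
open import Data.List.Relation.Binary.Pointwise using (Pointwise; []; _∷_)
open import Data.List.Membership.Propositional using (_∈_; _∉_; find; lose)
open import Data.List.Relation.Binary.Subset.Propositional using (_⊆_)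
open import Data.List.Relation.Binary.Subset.Propositional.Properties
  using (xs⊆xs++ys; xs⊆ys++xs; ++⁺ʳ; concatMap⁺)
open import Data.List.Relation.Binary.Subset.DecPropositional _≟V_ using (_⊆?_)
open import Data.List.Membership.DecPropositional using () renaming (_∈?_ to mem?)
import Data.List.Membership.Propositional.Properties as ∈
open import Data.List.Membership.Setoid.Properties using (∈-∷=⁺-updated)
import Data.List.Properties as List
import Data.List.Relation.Unary.All as All
import Data.List.Relation.Unary.All.Properties as AllP
open import Data.Maybe using (Maybe; just; nothing)
open import Data.Integer using (0ℤ; 1ℤ; +≤+) renaming (_+_ to _+ℤ_; _*_ to _*ℤ_; _≤_ to _≤ℤ_; _<_ to _<ℤ_)
open import Data.Nat using (ℕ; suc; _⊔_; _≤_; _<_; _≤?_; s≤s; z≤n; _∸_; _+_)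
open import Data.Nat.Properties
  using (_≟_; ≤-trans; <-irrefl; m≤m⊔n; m≤n⊔m; m≤n+m; +-cancelʳ-≡; m+n∸n≡m; suc-injective;
         m≤n⇒m<n∨m≡n; +-monoˡ-<; +-monoʳ-<; <-≤-trans; ≤-reflexive; m≤n⇒m≤1+n)
open import Data.Nat.Induction using (<-wellFounded)
open import Data.Empty using (⊥-elim)
open import Function using (_∘_)
open import Relation.Nullary using (¬_; Dec; yes; no)
open import Relation.Nullary.Decidable using (¬?; _×-dec_; _→-dec_)
open import Relation.Binary.Structures using (IsEquivalence)
import Data.List.Relation.Binary.Pointwise as Pointwise
open import Relation.Binary.PropositionalEquality using (setoid; _≡_; _≢_; refl; sym; trans; cong; cong₂; subst; subst₂; module ≡-Reasoning)
open import Function.Bundles using (_⇔_; mk⇔)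
open import Induction.WellFounded using (Acc; module Subrelation)
import Relation.Binary.Construct.On as On
open import Relation.Binary.Construct.Closure.ReflexiveTransitive using (Star; ε; _◅_)

≤-foldr-⊔ : ∀ {A : Set} (f : A → ℕ) {x} xs → x ∈ xs → f x ≤ foldr (λ y m → f y ⊔ m) 0 xs
≤-foldr-⊔ f (y ∷ ys) (here refl) = m≤m⊔n _ _
≤-foldr-⊔ f (y ∷ ys) (there x∈) = ≤-trans (≤-foldr-⊔ f ys x∈) (m≤n⊔m _ _)

map≡map⇒≡ : ∀ {A B : Set} (f g : A → B) xs → map f xs ≡ map g xs → ∀ {x} → x ∈ xs → f x ≡ g x
map≡map⇒≡ f g (y ∷ ys) eq (here refl) = List.∷-injectiveˡ eq
map≡map⇒≡ f g (y ∷ ys) eq (there x∈) = map≡map⇒≡ f g ys (List.∷-injectiveʳ eq) x∈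

decide-∃∈ : ∀ {A : Set} {Q : A → Set} xs → (∀ {x} → x ∈ xs → Dec (Q x)) → Dec (∃ λ x → x ∈ xs × Q x)
decide-∃∈ [] Q? = no λ ()
decide-∃∈ (y ∷ ys) Q? with Q? (here refl) | decide-∃∈ ys (Q? ∘ there)
... | yes q | _ = yes (y , here refl , q)
... | no _  | yes (x , x∈ , q) = yes (x , there x∈ , q)
... | no ¬q | no ¬r = no λ { (x , here refl , q) → ¬q q ; (x , there x∈ , q) → ¬r (x , x∈ , q) }

all-or-counterexample : ∀ {A : Set} {Q W : A → Set} → (∀ x → Q x ⊎ W x) → ∀ xs →
                        (∀ {x} → x ∈ xs → Q x) ⊎ (∃ λ x → x ∈ xs × W x)
all-or-counterexample Q⊎W [] = inj₁ λ ()
all-or-counterexample Q⊎W (y ∷ ys) with Q⊎W y | all-or-counterexample Q⊎W ys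
... | inj₂ w | _ = inj₂ (y , here refl , w)
... | inj₁ _ | inj₂ (x , x∈ , w) = inj₂ (x , there x∈ , w)
... | inj₁ q | inj₁ qs = inj₁ λ { (here refl) → q ; (there x∈) → qs x∈ }

all-splits-or-counterexample : ∀ {A : Set} (Q : List A → A → List A → Set) → (∀ L B R → Dec (Q L B R)) → ∀ xs →
  (∀ {L B R} → xs ≡ L ++ B ∷ R → Q L B R) ⊎ (∃ λ L → ∃ λ B → ∃ λ R → xs ≡ L ++ B ∷ R × ¬ Q L B R)
all-splits-or-counterexample Q Q? [] = inj₁ λ { {[]} () ; {_ ∷ _} () }
all-splits-or-counterexample Q Q? (x ∷ xs) with Q? [] x xs
... | no ¬q = inj₂ ([] , x , xs , refl , ¬q)
... | yes q with all-splits-or-counterexample (λ L → Q (x ∷ L)) (λ L → Q? (x ∷ L)) xs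
...   | inj₂ (L , B , R , refl , ¬q) = inj₂ (x ∷ L , B , R , refl , ¬q)
...   | inj₁ qs = inj₁ λ { {[]} refl → q ; {_ ∷ L} eq → qs-split L eq }
  where
    qs-split : ∀ L {y B R} → x ∷ xs ≡ y ∷ L ++ B ∷ R → Q (y ∷ L) B R
    qs-split L eq with refl ← List.∷-injectiveˡ eq = qs (List.∷-injectiveʳ eq)

∈-split : ∀ {A : Set} {xs : List A} L {B} R → xs ≡ L ++ B ∷ R → B ∈ xs
∈-split L R refl = ∈.∈-++⁺ʳ L (here refl)

length-filter-mono : ∀ {A : Set} {Q R : A → Set} (Q? : ∀ x → Dec (Q x)) (R? : ∀ x → Dec (R x)) zs →
  (∀ {z} → z ∈ zs → Q z → R z) → length (filter Q? zs) ≤ length (filter R? zs)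
length-filter-mono Q? R? [] Q⇒R = z≤n
length-filter-mono Q? R? (z ∷ zs) Q⇒R with Q? z | R? z | length-filter-mono Q? R? zs (Q⇒R ∘ there)
... | yes _ | yes _ | ih = s≤s ih
... | no _  | yes _ | ih = m≤n⇒m≤1+n ih
... | no _  | no _  | ih = ih
... | yes q | no ¬r | _  = ⊥-elim (¬r (Q⇒R (here refl) q))

length-filter-mono-< : ∀ {A : Set} {Q R : A → Set} (Q? : ∀ x → Dec (Q x)) (R? : ∀ x → Dec (R x)) zs →
  (∀ {z} → z ∈ zs → Q z → R z) → ∀ {w} → w ∈ zs → ¬ Q w → R w → length (filter Q? zs) < length (filter R? zs)
length-filter-mono-< Q? R? (z ∷ zs) Q⇒R (here refl) ¬q r with Q? z | R? z
... | no _  | yes _ = s≤s (length-filter-mono Q? R? zs (Q⇒R ∘ there))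
... | yes q | _     = ⊥-elim (¬q q)
... | no _  | no ¬r = ⊥-elim (¬r r)
length-filter-mono-< Q? R? (z ∷ zs) Q⇒R (there w∈) ¬q r with Q? z | R? z | length-filter-mono-< Q? R? zs (Q⇒R ∘ there) w∈ ¬q r
... | yes _ | yes _ | ih = s≤s ih
... | no _  | yes _ | ih = m≤n⇒m≤1+n ih
... | no _  | no _  | ih = ih
... | yes q | no ¬r | _  = ⊥-elim (¬r (Q⇒R (here refl) q))

∈-∷=⁻ : ∀ {A : Set} {x y v : A} {xs} (x∈ : x ∈ xs) → y ∈ (x∈ ∷= v) → y ≡ v ⊎ y ∈ xs
∈-∷=⁻ (here refl) (here refl) = inj₁ refl
∈-∷=⁻ (here refl) (there y∈) = inj₂ (there y∈)
∈-∷=⁻ (there x∈) (here refl) = inj₂ (here refl)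
∈-∷=⁻ (there x∈) (there y∈) with ∈-∷=⁻ x∈ y∈
... | inj₁ y≡v = inj₁ y≡v
... | inj₂ y∈′ = inj₂ (there y∈′)

∈-∷=⁺ : ∀ {A : Set} {x y v : A} {xs} (x∈ : x ∈ xs) → y ∈ xs → y ∈ (x∈ ∷= v) ⊎ y ≡ x
∈-∷=⁺ (here refl) (here refl) = inj₂ refl
∈-∷=⁺ (here refl) (there y∈) = inj₁ (there y∈)
∈-∷=⁺ (there x∈) (here refl) = inj₁ (here refl)
∈-∷=⁺ (there x∈) (there y∈) with ∈-∷=⁺ x∈ y∈
... | inj₁ y∈′ = inj₁ (there y∈′)
... | inj₂ y≡x = inj₂ y≡x

sum-map-∷=-< : ∀ {A : Set} (f : A → ℕ) {x v : A} {xs} (x∈ : x ∈ xs) → f v < f x → sum (map f (x∈ ∷= v)) < sum (map f xs)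
sum-map-∷=-< f {xs = y ∷ ys} (here refl) lt = +-monoˡ-< (sum (map f ys)) lt
sum-map-∷=-< f {xs = y ∷ ys} (there x∈) lt = +-monoʳ-< (f y) (sum-map-∷=-< f x∈ lt)

idRen : Ren
idRen _ n = n

idRen-injective : Injective idRen
idRen-injective _ _ _ eq = eq

shift-injective : ∀ k → Injective (shift k)
shift-injective k _ m n = +-cancelʳ-≡ k m n

renV-injective : ∀ {ρ} → Injective ρ → ∀ {x y} → renV ρ x ≡ renV ρ y → x ≡ y
renV-injective ρ-inj {s , m} {s' , n} eq with cong proj₁ eq
... | refl = cong (s ,_) (ρ-inj s m n (cong proj₂ eq))

renA-idRen : ∀ A → renA idRen A ≡ A
renA-idRen (atom p xs) = cong (atom p) (List.map-id xs)

-- Two atoms are variants iff their argument lists can be paired off into a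
-- sort-preserving partial bijection; the latter is decidable.

SameSort : Var × Var → Set
SameSort p = proj₁ (proj₁ p) ≡ proj₁ (proj₂ p)

Coherent : Var × Var → Var × Var → Set
Coherent p q = (proj₁ p ≡ proj₁ q → proj₂ p ≡ proj₂ q) × (proj₂ p ≡ proj₂ q → proj₁ p ≡ proj₁ q)

IsPartialRenaming : List (Var × Var) → Set
IsPartialRenaming ps = All SameSort ps × All (λ p → All (Coherent p) ps) ps

Alignable : Atom → Atom → Set
Alignable A A' = pred A ≡ pred A' × length (args A) ≡ length (args A') × IsPartialRenaming (zip (args A) (args A'))

alignable? : ∀ A A' → Dec (Alignable A A')
alignable? A A' =
  pred A ≟ pred A' ×-dec length (args A) ≟ length (args A') ×-dec
  all? (λ p → proj₁ (proj₁ p) ≟S proj₁ (proj₂ p)) ps ×-dec all? (λ p → all? (coherent? p) ps) ps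
  where
    ps = zip (args A) (args A')
    coherent? : ∀ p q → Dec (Coherent p q)
    coherent? p q = ((proj₁ p ≟V proj₁ q) →-dec (proj₂ p ≟V proj₂ q)) ×-dec
                    ((proj₂ p ≟V proj₂ q) →-dec (proj₁ p ≟V proj₁ q))

lookupPair : List (Var × Var) → Var → Maybe ℕ
lookupPair [] x = nothing
lookupPair ((a , b) ∷ ps) x with a ≟V x
... | yes _ = just (proj₂ b)
... | no _  = lookupPair ps x

lookupPair-just : ∀ ps x {k} → lookupPair ps x ≡ just k → ∃ λ q → q ∈ ps × proj₁ q ≡ x × proj₂ (proj₂ q) ≡ k
lookupPair-just ((a , b) ∷ ps) x eq with a ≟V x
lookupPair-just ((a , b) ∷ ps) x refl | yes a≡x = (a , b) , here refl , a≡x , refl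
... | no _ with q , q∈ , q≡ ← lookupPair-just ps x eq = q , there q∈ , q≡

lookupPair-nothing : ∀ ps x → lookupPair ps x ≡ nothing → ∀ {q} → q ∈ ps → proj₁ q ≢ x
lookupPair-nothing ((a , b) ∷ ps) x eq q∈ with a ≟V x
lookupPair-nothing ((a , b) ∷ ps) x () q∈ | yes _
lookupPair-nothing ((a , b) ∷ ps) x eq (here refl) | no a≢x = a≢x
lookupPair-nothing ((a , b) ∷ ps) x eq (there q∈) | no _ = lookupPair-nothing ps x eq q∈

maxTarget : List (Var × Var) → ℕ
maxTarget = foldr (λ p m → proj₂ (proj₂ p) ⊔ m) 0

-- Unpaired variables are sent above every target index, which keeps the
-- renaming injective.
pairingRen : List (Var × Var) → Ren
pairingRen ps s n with lookupPair ps (s , n)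
... | just k  = k
... | nothing = n + suc (maxTarget ps)

≡-Var : ∀ {x y : Var} → proj₁ x ≡ proj₁ y → proj₂ x ≡ proj₂ y → x ≡ y
≡-Var refl refl = refl

target≢shifted : ∀ ps {q} → q ∈ ps → ∀ n → proj₂ (proj₂ q) ≢ n + suc (maxTarget ps)
target≢shifted ps q∈ n eq = <-irrefl refl (≤-trans (s≤s (≤-foldr-⊔ (proj₂ ∘ proj₂) ps q∈))
                                               (≤-trans (m≤n+m _ n) (≤-reflexive (sym eq))))

pairingRen-injective : ∀ ps → IsPartialRenaming ps → Injective (pairingRen ps)
pairingRen-injective ps (sorts , coh) s m n eq
  with lookupPair ps (s , m) in em | lookupPair ps (s , n) in en
... | just k | just k'
  with q , q∈ , q₁≡ , q₂≡ ← lookupPair-just ps _ em | q' , q'∈ , q'₁≡ , q'₂≡ ← lookupPair-just ps _ en =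
  cong proj₂ (trans (sym q₁≡) (trans (proj₂ (lookup (lookup coh q∈) q'∈) same-target) q'₁≡))
  where
    same-target : proj₂ q ≡ proj₂ q'
    same-target = ≡-Var (trans (sym (lookup sorts q∈)) (trans (cong proj₁ q₁≡) (trans (sym (cong proj₁ q'₁≡)) (lookup sorts q'∈))))
                        (trans q₂≡ (trans eq (sym q'₂≡)))
... | just k | nothing with q , q∈ , _ , refl ← lookupPair-just ps _ em = ⊥-elim (target≢shifted ps q∈ n eq)
... | nothing | just k with q , q∈ , _ , refl ← lookupPair-just ps _ en = ⊥-elim (target≢shifted ps q∈ m (sym eq))
... | nothing | nothing = +-cancelʳ-≡ (suc (maxTarget ps)) m n eq

pairingRen-maps : ∀ ps → IsPartialRenaming ps → ∀ {p} → p ∈ ps → renV (pairingRen ps) (proj₁ p) ≡ proj₂ p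
pairingRen-maps ps (sorts , coh) {(s , m) , y} p∈ with lookupPair ps (s , m) in em
... | just k with q , q∈ , q₁≡ , refl ← lookupPair-just ps _ em =
  ≡-Var (lookup sorts p∈) (cong proj₂ (proj₁ (lookup (lookup coh q∈) p∈) q₁≡))
... | nothing = ⊥-elim (lookupPair-nothing ps _ em p∈ refl)

map-zip : ∀ (f : Var → Var) xs ys → length xs ≡ length ys →
          (∀ {p} → p ∈ zip xs ys → f (proj₁ p) ≡ proj₂ p) → map f xs ≡ ys
map-zip f [] [] _ _ = refl
map-zip f (x ∷ xs) (y ∷ ys) len f≡ = cong₂ _∷_ (f≡ (here refl)) (map-zip f xs ys (suc-injective len) (f≡ ∘ there))

alignable⇒variant : ∀ {A A'} → Alignable A A' → Variant A A'
alignable⇒variant {atom p xs} {atom .p ys} (refl , len , pr) =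
  pairingRen ps , pairingRen-injective ps pr , cong (atom p) (map-zip (renV (pairingRen ps)) xs ys len (pairingRen-maps ps pr))
  where ps = zip xs ys

∈-zip-maps : ∀ (f g : Var → Var) (xs : List Var) {p} → p ∈ zip (map f xs) (map g xs) → ∃ λ x → p ≡ (f x , g x)
∈-zip-maps f g (x ∷ xs) (here refl) = x , refl
∈-zip-maps f g (x ∷ xs) (there p∈) = ∈-zip-maps f g xs p∈

∈-zip-mapˡ : ∀ (f : Var → Var) (xs ys : List Var) {p} → p ∈ zip (map f xs) ys → ∃ λ q → q ∈ zip xs ys × p ≡ (f (proj₁ q) , proj₂ q)
∈-zip-mapˡ f (x ∷ xs) (y ∷ ys) (here refl) = (x , y) , here refl , refl
∈-zip-mapˡ f (x ∷ xs) (y ∷ ys) (there p∈) with q , q∈ , eq ← ∈-zip-mapˡ f xs ys p∈ = q , there q∈ , eq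

alignable-renamings : ∀ {f g} → Injective f → Injective g → ∀ A → Alignable (renA f A) (renA g A)
alignable-renamings {f} {g} f-inj g-inj (atom p xs) =
  refl , trans (List.length-map (renV f) xs) (sym (List.length-map (renV g) xs)) ,
  tabulate sorts , tabulate (λ p∈ → tabulate (coherent p∈))
  where
    ps : List (Var × Var)
    ps = zip (map (renV f) xs) (map (renV g) xs)
    sorts : ∀ {p} → p ∈ ps → SameSort p
    sorts p∈ with _ , refl ← ∈-zip-maps (renV f) (renV g) xs p∈ = refl
    coherent : ∀ {p} → p ∈ ps → ∀ {q} → q ∈ ps → Coherent p q
    coherent p∈ q∈ with _ , refl ← ∈-zip-maps (renV f) (renV g) xs p∈ | _ , refl ← ∈-zip-maps (renV f) (renV g) xs q∈ =
      cong (renV g) ∘ renV-injective f-inj , cong (renV f) ∘ renV-injective g-inj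

variant⇒alignable : ∀ {A A'} → Variant A A' → Alignable A A'
variant⇒alignable {A} (ρ , ρ-inj , refl) =
  subst (λ X → Alignable X (renA ρ A)) (renA-idRen A) (alignable-renamings idRen-injective ρ-inj A)

alignable-renameˡ : ∀ {f} → Injective f → ∀ {A A'} → Alignable A A' → Alignable (renA f A) A'
alignable-renameˡ {f} f-inj {atom p xs} {atom p' ys} (p≡ , len , sorts , coh) =
  p≡ , trans (List.length-map (renV f) xs) len , tabulate sorts' , tabulate (λ p∈ → tabulate (coherent p∈))
  where
    ps : List (Var × Var)
    ps = zip (map (renV f) xs) ys
    sorts' : ∀ {p} → p ∈ ps → SameSort p
    sorts' p∈ with _ , x∈ , refl ← ∈-zip-mapˡ (renV f) xs ys p∈ = lookup sorts x∈
    coherent : ∀ {p} → p ∈ ps → ∀ {q} → q ∈ ps → Coherent p q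
    coherent p∈ q∈ with _ , x∈ , refl ← ∈-zip-mapˡ (renV f) xs ys p∈ | _ , y∈ , refl ← ∈-zip-mapˡ (renV f) xs ys q∈ =
      proj₁ c ∘ renV-injective f-inj , cong (renV f) ∘ proj₂ c
      where c = lookup (lookup coh x∈) y∈

offset : DefCl → ℕ
offset D = suc (maxVar (hvars D ++ args (body D)))

unfoldWith : DefCl → Clause → Clause
unfoldWith D K = clause (atom (newp D) (hvars D))
                        (eqArgs (args (body D)) (args (hd K')) ++ con K')
                        (bd K')
  where K' = renCl (shift (offset D)) K

data ClsOrigin (P : Program) (Δ : Defs) : Clause → Set where
  unsafe   : ∀ {C} → C ∈ P → pred (hd C) ≡ unsafeP → ClsOrigin P Δ C
  unfolded : ∀ {D K} → D ∈ Δ → K ∈ P → pred (hd K) ≡ pred (body D) → ClsOrigin P Δ (unfoldWith D K)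

∈Cls⁻ : ∀ P Δ {C} → C ∈ Cls P Δ → ClsOrigin P Δ C
∈Cls⁻ P Δ C∈ with ∈.∈-++⁻ (filter (λ K → pred (hd K) ≟ unsafeP) P) C∈
... | inj₁ C∈ᵤ = uncurry unsafe (∈.∈-filter⁻ (λ K → pred (hd K) ≟ unsafeP) C∈ᵤ)
... | inj₂ C∈ᵤₙ
  with D , D∈ , C∈D ← find (∈.∈-concatMap⁻ (unfoldDef P) {xs = Δ} C∈ᵤₙ)
  with K , K∈ , refl ← ∈.∈-map⁻ (unfoldWith D) C∈D
  with K∈P , K≡ ← ∈.∈-filter⁻ (λ K → pred (hd K) ≟ pred (body D)) {xs = P} K∈ = unfolded D∈ K∈P K≡

∈Cls⁺-unsafe : ∀ P Δ {C} → C ∈ P → pred (hd C) ≡ unsafeP → C ∈ Cls P Δ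
∈Cls⁺-unsafe P Δ C∈ C≡ = ∈.∈-++⁺ˡ (∈.∈-filter⁺ (λ K → pred (hd K) ≟ unsafeP) C∈ C≡)

∈Cls⁺-unfolded : ∀ P Δ {D K} → D ∈ Δ → K ∈ P → pred (hd K) ≡ pred (body D) → unfoldWith D K ∈ Cls P Δ
∈Cls⁺-unfolded P Δ {D} D∈ K∈ K≡ =
  ∈.∈-++⁺ʳ (filter (λ K → pred (hd K) ≟ unsafeP) P)
    (∈.∈-concatMap⁺ (unfoldDef P) (lose D∈ (∈.∈-map⁺ (unfoldWith D) (∈.∈-filter⁺ (λ K → pred (hd K) ≟ pred (body D)) K∈ K≡))))

body-renames-program-atom : ∀ P Δ {C B} → C ∈ Cls P Δ → B ∈ bd C →
  ∃ λ A → A ∈ concatMap bd P × ∃ λ f → Injective f × renA f A ≡ B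
body-renames-program-atom P Δ C∈ B∈ with ∈Cls⁻ P Δ C∈
... | unsafe C∈P _ = _ , ∈.∈-concatMap⁺ bd (lose C∈P B∈) , idRen , idRen-injective , renA-idRen _
... | unfolded {D} D∈ K∈ _ with A , A∈ , refl ← ∈.∈-map⁻ (renA (shift (offset D))) B∈ =
  A , ∈.∈-concatMap⁺ bd (lose K∈ A∈) , shift (offset D) , shift-injective (offset D) , refl

contextVars : Atom → Constr → List Atom → List Var
contextVars H c As = args H ++ varsC c ++ concatMap args As

contextVars-mono : ∀ H c {As Bs} → As ⊆ Bs → contextVars H c As ⊆ contextVars H c Bs
contextVars-mono H c As⊆Bs = ++⁺ʳ (args H) (++⁺ʳ (varsC c) (concatMap⁺ args As⊆Bs))

contextVars⁺ : ∀ H c {As} → concatMap args As ⊆ contextVars H c As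
contextVars⁺ H c = ∈.∈-++⁺ʳ (args H) ∘ ∈.∈-++⁺ʳ (varsC c)

linkvars⊆args : ∀ H c L B R → linkvars H c L B R ⊆ args B
linkvars⊆args H c L B R x∈ =
  proj₁ (∈.∈-filter⁻ (λ x → mem? _≟V_ x (contextVars H c (L ++ R)))
          (∈.∈-deduplicate⁻ _≟V_ (filter (λ x → mem? _≟V_ x (contextVars H c (L ++ R))) (args B)) x∈))

Covered : Defs → Atom → Set
Covered Δ A = ∃ λ D → D ∈ Δ × Alignable A (body D)

covered? : ∀ Δ A → Dec (Covered Δ A)
covered? Δ A = decide-∃∈ Δ (λ {D} _ → alignable? A (body D))

uncovered : Program → Defs → ℕ
uncovered P Δ = length (filter (¬? ∘ covered? Δ) (concatMap bd P))

hidden : DefCl → ℕ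
hidden D = length (filter (λ x → ¬? (mem? _≟V_ x (hvars D))) (args (body D)))

measure : Program → Defs → ℕ × ℕ
measure P Δ = uncovered P Δ , sum (map hidden Δ)

_<ₘ_ : ℕ × ℕ → ℕ × ℕ → Set
_<ₘ_ = ×-Lex _≡_ _<_ _<_

uncovered-mono : ∀ P {Δ Δ'} → (∀ {A} → Covered Δ A → Covered Δ' A) → uncovered P Δ' ≤ uncovered P Δ
uncovered-mono P {Δ} {Δ'} cov = length-filter-mono (¬? ∘ covered? Δ') (¬? ∘ covered? Δ) (concatMap bd P) (λ _ → _∘ cov)

add-covers : ∀ P {Δ C B n V} → C ∈ Cls P Δ → B ∈ bd C → ¬ (∃ λ D → D ∈ Δ × Variant B (body D)) →
             uncovered P (Δ ++ [ defcl n V B ]) < uncovered P Δ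
add-covers P {Δ} C∈ B∈ ¬var with A , A∈ , f , f-inj , refl ← body-renames-program-atom P Δ C∈ B∈ =
  length-filter-mono-< (¬? ∘ covered? Δ') (¬? ∘ covered? Δ) (concatMap bd P) (λ _ → _∘ covered-kept) A∈ (λ ¬c → ¬c covered-new) uncovered-before
  where
    Δ' = Δ ++ [ defcl _ _ (renA f A) ]
    covered-kept : ∀ {A} → Covered Δ A → Covered Δ' A
    covered-kept (D , D∈ , al) = D , ∈.∈-++⁺ˡ D∈ , al
    covered-new : Covered Δ' A
    covered-new = _ , ∈.∈-++⁺ʳ Δ (here refl) ,
                  subst (λ X → Alignable X (renA f A)) (renA-idRen A) (alignable-renamings idRen-injective f-inj A)
    uncovered-before : ¬ Covered Δ A
    uncovered-before (D , D∈ , al) = ¬var (D , D∈ , alignable⇒variant (alignable-renameˡ f-inj al))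

foldable-by-variant : ∀ {Δ D B V ϑ} → D ∈ Δ → Injective ϑ → renA ϑ B ≡ body D → V ⊆ args B →
                      (∀ {v} → v ∈ V → renV ϑ v ∈ hvars D) → Foldable Δ V B
foldable-by-variant {D = D} {B} {V} {ϑ} D∈ ϑ-inj ϑB≡ V⊆B V↦head = D , D∈ , ρ , ρ-inj , ρ-back , V⊆head
  where
    variant : Variant (body D) B
    variant = alignable⇒variant (subst₂ Alignable ϑB≡ (renA-idRen B) (alignable-renamings ϑ-inj idRen-injective B))
    ρ = proj₁ variant
    ρ-inj = proj₁ (proj₂ variant)
    ρ-back = proj₂ (proj₂ variant)
    round-trip : ∀ {v} → v ∈ args B → renV ρ (renV ϑ v) ≡ v
    round-trip = map≡map⇒≡ (renV ρ ∘ renV ϑ) (λ v → v) (args B) (begin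
      map (renV ρ ∘ renV ϑ) (args B)    ≡⟨ List.map-∘ (args B) ⟩
      map (renV ρ) (args (renA ϑ B))  ≡⟨ cong (args ∘ renA ρ) ϑB≡ ⟩
      args (renA ρ (body D))          ≡⟨ cong args ρ-back ⟩
      args B                          ≡⟨ List.map-id (args B) ⟨
      map (λ v → v) (args B)          ∎)
      where open ≡-Reasoning
    V⊆head : V ⊆ map (renV ρ) (hvars D)
    V⊆head v∈ = subst (_∈ map (renV ρ) (hvars D)) (round-trip (V⊆B v∈)) (∈.∈-map⁺ (renV ρ) (V↦head v∈))

merge-hides-less : ∀ {Δ D B V ϑ n} → D ∈ Δ → Injective ϑ → renA ϑ B ≡ body D → V ⊆ args B → ¬ Foldable Δ V B →
                   hidden (defcl n (deduplicate _≟V_ (hvars D ++ map (renV ϑ) V)) (body D)) < hidden D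
merge-hides-less {D = D} {B} {V} {ϑ} D∈ ϑ-inj ϑB≡ V⊆B ¬fold with all? (λ v → mem? _≟V_ (renV ϑ v) (hvars D)) V
... | yes V↦head = ⊥-elim (¬fold (foldable-by-variant D∈ ϑ-inj ϑB≡ V⊆B (lookup V↦head)))
... | no ¬V↦head with v , v∈ , ϑv∉ ← find (AllP.¬All⇒Any¬ (λ v → mem? _≟V_ (renV ϑ v) (hvars D)) V ¬V↦head) =
  length-filter-mono-< (λ x → ¬? (mem? _≟V_ x merged)) (λ x → ¬? (mem? _≟V_ x (hvars D))) (args (body D))
    (λ _ x∉ x∈ → x∉ (∈.∈-deduplicate⁺ _≟V_ (∈.∈-++⁺ˡ x∈)))
    (subst (λ X → renV ϑ v ∈ args X) ϑB≡ (∈.∈-map⁺ (renV ϑ) (V⊆B v∈)))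
    (λ ϑv∉merged → ϑv∉merged (∈.∈-deduplicate⁺ _≟V_ (∈.∈-++⁺ʳ (hvars D) (∈.∈-map⁺ (renV ϑ) v∈))))
    ϑv∉
  where merged = deduplicate _≟V_ (hvars D ++ map (renV ϑ) V)

<ₘ-second : ∀ {u u' d d'} → u' ≤ u → d' < d → (u' , d') <ₘ (u , d)
<ₘ-second u'≤u d'<d with m≤n⇒m<n∨m≡n u'≤u
... | inj₁ u'<u = inj₁ u'<u
... | inj₂ u'≡u = inj₂ (u'≡u , d'<d)

step-decreases : ∀ P {Δ Δ'} → Step P Δ Δ' → measure P Δ' <ₘ measure P Δ
step-decreases P (add {L = L} {R = R} C∈ split _ ¬var _) = inj₁ (add-covers P C∈ (∈-split L R split) ¬var)
step-decreases P (merge {C} {L} {B} {R} {n} {D} C∈ split ¬fold D∈ ϑ ϑ-inj ϑB≡ _) =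
  <ₘ-second (uncovered-mono P still-covered)
            (sum-map-∷=-< hidden D∈ (merge-hides-less {n = n} D∈ ϑ-inj ϑB≡ (linkvars⊆args (hd C) (con C) L B R) ¬fold))
  where
    still-covered : ∀ {A} → Covered _ A → Covered (D∈ ∷= _) A
    still-covered (D' , D'∈ , al) with ∈-∷=⁺ D∈ D'∈
    ... | inj₁ D'∈′ = D' , D'∈′ , al
    ... | inj₂ refl = _ , ∈-∷=⁺-updated (setoid DefCl) D∈ , al

termination : ∀ P → Acc (λ Δ' Δ → Step P Δ Δ') []
termination P = Subrelation.accessible (step-decreases P)
                  (On.accessible (measure P) (×-wellFounded <-wellFounded <-wellFounded (measure P [])))

record WellFormed (Δ : Defs) : Set where
  field
    head⊆body      : ∀ {D} → D ∈ Δ → hvars D ⊆ args (body D)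
    newp≢unsafe    : ∀ {D} → D ∈ Δ → newp D ≢ unsafeP
    newp-injective : ∀ {D D'} → D ∈ Δ → D' ∈ Δ → newp D ≡ newp D' → D ≡ D'
open WellFormed

wellFormed-extend : ∀ {Δ Δ' N} → WellFormed Δ → (∀ {D} → D ∈ Δ' → D ∈ Δ ⊎ D ≡ N) →
  hvars N ⊆ args (body N) → newp N ≢ unsafeP → newp N ∉ map newp Δ → WellFormed Δ'
wellFormed-extend {Δ} {Δ'} {N} wf old⊎new N-head N≢unsafe N-fresh = record
  { head⊆body = head⊆body′ ; newp≢unsafe = newp≢unsafe′ ; newp-injective = injective }
  where
    head⊆body′ : ∀ {D} → D ∈ Δ' → hvars D ⊆ args (body D)
    head⊆body′ D∈ with old⊎new D∈
    ... | inj₁ D∈Δ = head⊆body wf D∈Δ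
    ... | inj₂ refl = N-head
    newp≢unsafe′ : ∀ {D} → D ∈ Δ' → newp D ≢ unsafeP
    newp≢unsafe′ D∈ with old⊎new D∈
    ... | inj₁ D∈Δ = newp≢unsafe wf D∈Δ
    ... | inj₂ refl = N≢unsafe
    injective : ∀ {D D'} → D ∈ Δ' → D' ∈ Δ' → newp D ≡ newp D' → D ≡ D'
    injective D∈ D'∈ eq with old⊎new D∈ | old⊎new D'∈
    ... | inj₁ D∈Δ | inj₁ D'∈Δ = newp-injective wf D∈Δ D'∈Δ eq
    ... | inj₁ D∈Δ | inj₂ refl = ⊥-elim (N-fresh (subst (_∈ map newp Δ) eq (∈.∈-map⁺ newp D∈Δ)))
    ... | inj₂ refl | inj₁ D'∈Δ = ⊥-elim (N-fresh (subst (_∈ map newp Δ) (sym eq) (∈.∈-map⁺ newp D'∈Δ)))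
    ... | inj₂ refl | inj₂ refl = refl

step-wellFormed : ∀ {P Δ Δ'} → WellFormed Δ → Step P Δ Δ' → WellFormed Δ'
step-wellFormed {Δ = Δ} wf (add {C} {L} {B} {R} _ _ _ _ (n≢unsafe , _ , n-fresh)) =
  wellFormed-extend wf old⊎new (linkvars⊆args (hd C) (con C) L B R) n≢unsafe n-fresh
  where
    old⊎new : ∀ {D} → D ∈ Δ ++ [ _ ] → D ∈ Δ ⊎ D ≡ _
    old⊎new D∈ with ∈.∈-++⁻ Δ D∈
    ... | inj₁ D∈Δ = inj₁ D∈Δ
    ... | inj₂ (here D≡) = inj₂ D≡
step-wellFormed wf (merge {C} {L} {B} {R} {D = D} _ _ _ D∈ ϑ _ ϑB≡ (n≢unsafe , _ , n-fresh)) =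
  wellFormed-extend wf (swap ∘ ∈-∷=⁻ D∈) merged⊆body n≢unsafe n-fresh
  where
    V = linkvars (hd C) (con C) L B R
    merged⊆body : deduplicate _≟V_ (hvars D ++ map (renV ϑ) V) ⊆ args (body D)
    merged⊆body x∈ with ∈.∈-++⁻ (hvars D) (∈.∈-deduplicate⁻ _≟V_ (hvars D ++ map (renV ϑ) V) x∈)
    ... | inj₁ x∈D = head⊆body wf D∈ x∈D
    ... | inj₂ x∈V with v , v∈ , refl ← ∈.∈-map⁻ (renV ϑ) x∈V =
      subst (λ X → renV ϑ v ∈ args X) ϑB≡ (∈.∈-map⁺ (renV ϑ) (linkvars⊆args (hd C) (con C) L B R v∈))

reach-wellFormed : ∀ {P Δ} → Reach P Δ → WellFormed Δ
reach-wellFormed = go (record { head⊆body = λ () ; newp≢unsafe = λ () ; newp-injective = λ () })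
  where
    go : ∀ {P Δ₀ Δ} → WellFormed Δ₀ → Star (Step P) Δ₀ Δ → WellFormed Δ
    go wf ε = wf
    go wf (step ◅ steps) = go (step-wellFormed wf step) steps

FoldsWith : List Var → Atom → DefCl → Set
FoldsWith V B D = ∃ λ ρ → Injective ρ × renA ρ (body D) ≡ B × V ⊆ map (renV ρ) (hvars D)

-- All renamings of body D onto B agree on the head variables, so it suffices
-- to test one of them.
foldsWith? : ∀ V B D → hvars D ⊆ args (body D) → Dec (FoldsWith V B D)
foldsWith? V B D head⊆ with alignable? (body D) B
... | no ¬al = no λ (ρ , ρ-inj , ρD≡B , _) → ¬al (variant⇒alignable (ρ , ρ-inj , ρD≡B))
... | yes al with alignable⇒variant al
... | ρ₀ , ρ₀-inj , ρ₀D≡B with V ⊆? map (renV ρ₀) (hvars D)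
... | yes V⊆ = yes (ρ₀ , ρ₀-inj , ρ₀D≡B , V⊆)
... | no V⊈ = no λ (ρ , _ , ρD≡B , V⊆) → V⊈ (image-ρ₀ ρ ρD≡B ∘ V⊆)
  where
    image-ρ₀ : ∀ ρ → renA ρ (body D) ≡ B → map (renV ρ) (hvars D) ⊆ map (renV ρ₀) (hvars D)
    image-ρ₀ ρ ρD≡B v∈ with x , x∈ , refl ← ∈.∈-map⁻ (renV ρ) v∈ =
      subst (_∈ map (renV ρ₀) (hvars D))
            (map≡map⇒≡ (renV ρ₀) (renV ρ) (args (body D)) (cong args (trans ρ₀D≡B (sym ρD≡B))) (head⊆ x∈))
            (∈.∈-map⁺ (renV ρ₀) x∈)

foldable? : ∀ {Δ} → WellFormed Δ → ∀ V B → Dec (Foldable Δ V B)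
foldable? {Δ} wf V B = decide-∃∈ Δ (λ {D} D∈ → foldsWith? V B D (head⊆body wf D∈))

fresh : ∀ P Δ → ∃ (Fresh P Δ)
fresh P Δ = n , (λ ()) , n∉ ∘ ∈.∈-++⁺ˡ , n∉ ∘ ∈.∈-++⁺ʳ (preds P)
  where
    used = preds P ++ map newp Δ
    n = suc (foldr _⊔_ 0 used)
    n∉ : n ∉ used
    n∉ n∈ = <-irrefl refl (≤-foldr-⊔ (λ m → m) used n∈)

progress : ∀ P Δ → Reach P Δ → Final P Δ ⊎ ∃ (Step P Δ)
progress P Δ reach
  with all-or-counterexample (λ C → all-splits-or-counterexample (λ L B R → Foldable Δ (linkvars (hd C) (con C) L B R) B)
                                      (λ L B R → foldable? (reach-wellFormed reach) _ B) (bd C))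
                             (Cls P Δ)
... | inj₁ final = inj₁ (λ C∈ split → final C∈ split)
... | inj₂ (C , C∈ , L , B , R , split , ¬fold) with decide-∃∈ Δ (λ {D} _ → alignable? B (body D)) | fresh P Δ
...   | yes (D , D∈ , al) | n , n-fresh with ϑ , ϑ-inj , ϑB≡ ← alignable⇒variant al =
  inj₂ (_ , merge C∈ split ¬fold D∈ ϑ ϑ-inj ϑB≡ n-fresh)
...   | no ¬al | n , n-fresh =
  inj₂ (_ , add C∈ split ¬fold (λ (D , D∈ , B≈D) → ¬al (D , D∈ , variant⇒alignable B≈D)) n-fresh)

foldAtom : ∀ {Δ V B} → Foldable Δ V B → ∃ (FoldAtom Δ V B)
foldAtom (D , D∈ , ρ , ρ-inj , ρD≡B , V⊆) = atom (newp D) (map (renV ρ) (hvars D)) , D , D∈ , ρ , ρ-inj , ρD≡B , V⊆ , refl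

foldBody : ∀ {Δ H c} L Bs → (∀ L' {B R} → Bs ≡ L' ++ B ∷ R → Foldable Δ (linkvars H c (L ++ L') B R) B) →
           ∃ (FoldBody Δ H c L Bs)
foldBody L [] _ = [] , []
foldBody {Δ} {H} {c} L (B ∷ R) foldable =
  let A , B↦A = foldAtom head-foldable ; As , R↦As = foldBody (L ++ [ B ]) R rest-foldable in A ∷ As , B↦A ∷ R↦As
  where
    head-foldable : Foldable Δ (linkvars H c L B R) B
    head-foldable = subst (λ X → Foldable Δ (linkvars H c X B R) B) (List.++-identityʳ L) (foldable [] refl)
    rest-foldable : ∀ L' {B' R'} → R ≡ L' ++ B' ∷ R' → Foldable Δ (linkvars H c ((L ++ [ B ]) ++ L') B' R') B'
    rest-foldable L' {B'} {R'} eq =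
      subst (λ X → Foldable Δ (linkvars H c X B' R') B') (sym (List.++-assoc L [ B ] L')) (foldable (B ∷ L') (cong (B ∷_) eq))

foldClauses : ∀ Δ Cs → (∀ {C L B R} → C ∈ Cs → bd C ≡ L ++ B ∷ R → Foldable Δ (linkvars (hd C) (con C) L B R) B) →
              ∃ (Pointwise (FoldedFrom Δ) Cs)
foldClauses Δ [] _ = [] , []
foldClauses Δ (C ∷ Cs) foldable
  with As , body↦As ← foldBody {Δ} {hd C} {con C} [] (bd C) (λ _ → foldable (here refl))
     | Cs' , Cs↦Cs' ← foldClauses Δ Cs (foldable ∘ there)
  = clause (hd C) (con C) As ∷ Cs' , (refl , refl , body↦As) ∷ Cs↦Cs'

val : Valuation → Var → GVal
val σ x = proj₁ x , σ x

_≋_ : List GVal → List GVal → Set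
_≋_ = Pointwise GEq

GEq-isEquivalence : IsEquivalence GEq
GEq-isEquivalence = record
  { refl  = λ { {int , _} → geq refl ; {arr , _} → geq λ _ → refl }
  ; sym   = λ { {int , _} (geq e) → geq (sym e) ; {arr , _} (geq e) → geq (sym ∘ e) }
  ; trans = λ { {int , _} (geq e) (geq e') → geq (trans e e') ; {arr , _} (geq e) (geq e') → geq λ i → trans (e i) (e' i) }
  }

module ≋ = IsEquivalence (Pointwise.isEquivalence GEq-isEquivalence)

≋-map : ∀ {A : Set} (f g : A → GVal) xs → (∀ {x} → x ∈ xs → GEq (f x) (g x)) → map f xs ≋ map g xs
≋-map f g [] _ = []
≋-map f g (x ∷ xs) f≈g = f≈g (here refl) ∷ ≋-map f g xs (f≈g ∘ there)

≋-map⁻ : ∀ {A : Set} (f g : A → GVal) xs → map f xs ≋ map g xs → ∀ {x} → x ∈ xs → GEq (f x) (g x)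
≋-map⁻ f g (y ∷ ys) (e ∷ _) (here refl) = e
≋-map⁻ f g (y ∷ ys) (_ ∷ es) (there x∈) = ≋-map⁻ f g ys es x∈

Pointwise-∈ˡ : ∀ {A B : Set} {R : A → B → Set} {xs ys} → Pointwise R xs ys → ∀ {x} → x ∈ xs → ∃ λ y → y ∈ ys × R x y
Pointwise-∈ˡ (r ∷ _) (here refl) = _ , here refl , r
Pointwise-∈ˡ (_ ∷ rs) (there x∈) with y , y∈ , r ← Pointwise-∈ˡ rs x∈ = y , there y∈ , r

Pointwise-∈ʳ : ∀ {A B : Set} {R : A → B → Set} {xs ys} → Pointwise R xs ys → ∀ {y} → y ∈ ys → ∃ λ x → x ∈ xs × R x y
Pointwise-∈ʳ (r ∷ _) (here refl) = _ , here refl , r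
Pointwise-∈ʳ (_ ∷ rs) (there y∈) with x , x∈ , r ← Pointwise-∈ʳ rs y∈ = x , there x∈ , r

M-resp-≋ : ∀ {P q vs ws} → M P (q , vs) → vs ≋ ws → M P (q , ws)
M-resp-≋ (rule C∈ sat body head) vs≋ws = rule C∈ sat body (≋.trans head vs≋ws)

Agree : Valuation → Valuation → List Var → Set
Agree σ σ' xs = ∀ {x} → x ∈ xs → σ x ≡ σ' x

map-val-agree : ∀ {σ σ'} xs → Agree σ σ' xs → map (val σ) xs ≡ map (val σ') xs
map-val-agree xs σ≡σ' = List.map-cong-local (tabulate (λ {x} x∈ → cong (proj₁ x ,_) (σ≡σ' x∈)))

inst-agree : ∀ {σ σ'} A → Agree σ σ' (args A) → inst σ A ≡ inst σ' A
inst-agree A σ≡σ' = cong (pred A ,_) (map-val-agree (args A) σ≡σ')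

_∘ᵣ_ : Valuation → Ren → Valuation
(σ ∘ᵣ ρ) x = σ (renV ρ x)

map-val-ren : ∀ σ ρ xs → map (val σ) (map (renV ρ) xs) ≡ map (val (σ ∘ᵣ ρ)) xs
map-val-ren σ ρ xs = sym (List.map-∘ xs)

inst-ren : ∀ σ ρ A → inst σ (renA ρ A) ≡ inst (σ ∘ᵣ ρ) A
inst-ren σ ρ A = cong (pred A ,_) (map-val-ren σ ρ (args A))

eval-agree : ∀ {σ σ' s} (t : Term s) → Agree σ σ' (varsT t) → eval σ t ≡ eval σ' t
eval-agree (var s n) σ≡σ' = σ≡σ' (here refl)
eval-agree (cst z) _ = refl
eval-agree (t ⊕ u) σ≡σ' = cong₂ _+ℤ_ (eval-agree t (σ≡σ' ∘ ∈.∈-++⁺ˡ)) (eval-agree u (σ≡σ' ∘ ∈.∈-++⁺ʳ (varsT t)))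
eval-agree (k ⊙ t) σ≡σ' = cong (k *ℤ_) (eval-agree t σ≡σ')
eval-agree (rd a i) σ≡σ' = cong₂ (λ f j → f j) (eval-agree a (σ≡σ' ∘ ∈.∈-++⁺ˡ)) (eval-agree i (σ≡σ' ∘ ∈.∈-++⁺ʳ (varsT a)))
eval-agree {σ} {σ'} (wr a i v) σ≡σ'
  rewrite eval-agree {σ} {σ'} a (σ≡σ' ∘ ∈.∈-++⁺ˡ)
        | eval-agree {σ} {σ'} i (σ≡σ' ∘ ∈.∈-++⁺ʳ (varsT a) ∘ ∈.∈-++⁺ˡ)
        | eval-agree {σ} {σ'} v (σ≡σ' ∘ ∈.∈-++⁺ʳ (varsT a) ∘ ∈.∈-++⁺ʳ (varsT i)) = refl

eval-ren : ∀ σ ρ {s} (t : Term s) → eval σ (renT ρ t) ≡ eval (σ ∘ᵣ ρ) t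
eval-ren σ ρ (var s n) = refl
eval-ren σ ρ (cst z) = refl
eval-ren σ ρ (t ⊕ u) = cong₂ _+ℤ_ (eval-ren σ ρ t) (eval-ren σ ρ u)
eval-ren σ ρ (k ⊙ t) = cong (k *ℤ_) (eval-ren σ ρ t)
eval-ren σ ρ (rd a i) = cong₂ (λ f j → f j) (eval-ren σ ρ a) (eval-ren σ ρ i)
eval-ren σ ρ (wr a i v) rewrite eval-ren σ ρ a | eval-ren σ ρ i | eval-ren σ ρ v = refl

SatA-agree : ∀ {σ σ'} a → Agree σ σ' (varsAC a) → SatA σ a ≡ SatA σ' a
SatA-agree (eqc s t u) σ≡σ' = cong₂ (EqV s) (eval-agree t (σ≡σ' ∘ ∈.∈-++⁺ˡ)) (eval-agree u (σ≡σ' ∘ ∈.∈-++⁺ʳ (varsT t)))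
SatA-agree (lec t u) σ≡σ' = cong₂ _≤ℤ_ (eval-agree t (σ≡σ' ∘ ∈.∈-++⁺ˡ)) (eval-agree u (σ≡σ' ∘ ∈.∈-++⁺ʳ (varsT t)))
SatA-agree (ltc t u) σ≡σ' = cong₂ _<ℤ_ (eval-agree t (σ≡σ' ∘ ∈.∈-++⁺ˡ)) (eval-agree u (σ≡σ' ∘ ∈.∈-++⁺ʳ (varsT t)))

Sat-agree : ∀ {σ σ'} c → Agree σ σ' (varsC c) → Sat σ c → Sat σ' c
Sat-agree [] _ [] = []
Sat-agree (a ∷ c) σ≡σ' (sa ∷ sc) =
  subst (λ X → X) (SatA-agree a (σ≡σ' ∘ ∈.∈-++⁺ˡ)) sa ∷ Sat-agree c (σ≡σ' ∘ ∈.∈-++⁺ʳ (varsAC a)) sc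

SatA-ren : ∀ σ ρ a → SatA σ (renAC ρ a) ≡ SatA (σ ∘ᵣ ρ) a
SatA-ren σ ρ (eqc s t u) = cong₂ (EqV s) (eval-ren σ ρ t) (eval-ren σ ρ u)
SatA-ren σ ρ (lec t u) = cong₂ _≤ℤ_ (eval-ren σ ρ t) (eval-ren σ ρ u)
SatA-ren σ ρ (ltc t u) = cong₂ _<ℤ_ (eval-ren σ ρ t) (eval-ren σ ρ u)

Sat-ren⁺ : ∀ σ ρ c → Sat (σ ∘ᵣ ρ) c → Sat σ (map (renAC ρ) c)
Sat-ren⁺ σ ρ [] [] = []
Sat-ren⁺ σ ρ (a ∷ c) (sa ∷ sc) = subst (λ X → X) (sym (SatA-ren σ ρ a)) sa ∷ Sat-ren⁺ σ ρ c sc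

Sat-ren⁻ : ∀ σ ρ c → Sat σ (map (renAC ρ) c) → Sat (σ ∘ᵣ ρ) c
Sat-ren⁻ σ ρ [] [] = []
Sat-ren⁻ σ ρ (a ∷ c) (sa ∷ sc) = subst (λ X → X) (SatA-ren σ ρ a) sa ∷ Sat-ren⁻ σ ρ c sc

¬1≤0 : ¬ (1ℤ ≤ℤ 0ℤ)
¬1≤0 (+≤+ ())

Sat-eqArgs⁻ : ∀ σ xs ys → Sat σ (eqArgs xs ys) → map (val σ) xs ≋ map (val σ) ys
Sat-eqArgs⁻ σ [] [] _ = []
Sat-eqArgs⁻ σ [] (_ ∷ _) (f ∷ _) = ⊥-elim (¬1≤0 f)
Sat-eqArgs⁻ σ (_ ∷ _) [] (f ∷ _) = ⊥-elim (¬1≤0 f)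
Sat-eqArgs⁻ σ ((int , _) ∷ xs) ((int , _) ∷ ys) (e ∷ es) = geq e ∷ Sat-eqArgs⁻ σ xs ys es
Sat-eqArgs⁻ σ ((int , _) ∷ xs) ((arr , _) ∷ ys) (f ∷ _) = ⊥-elim (¬1≤0 f)
Sat-eqArgs⁻ σ ((arr , _) ∷ xs) ((int , _) ∷ ys) (f ∷ _) = ⊥-elim (¬1≤0 f)
Sat-eqArgs⁻ σ ((arr , _) ∷ xs) ((arr , _) ∷ ys) (e ∷ es) = geq e ∷ Sat-eqArgs⁻ σ xs ys es

Sat-eqArgs⁺ : ∀ σ xs ys → map (val σ) xs ≋ map (val σ) ys → Sat σ (eqArgs xs ys)
Sat-eqArgs⁺ σ [] [] [] = []
Sat-eqArgs⁺ σ ((int , _) ∷ xs) ((.int , _) ∷ ys) (geq e ∷ es) = e ∷ Sat-eqArgs⁺ σ xs ys es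
Sat-eqArgs⁺ σ ((arr , _) ∷ xs) ((.arr , _) ∷ ys) (geq e ∷ es) = e ∷ Sat-eqArgs⁺ σ xs ys es

patch : Valuation → Valuation → Ren → List Var → Valuation
patch σ τ ρ [] y = σ y
patch σ τ ρ ((s' , m) ∷ xs) (s , n) with s' ≟S s
... | no _ = patch σ τ ρ xs (s , n)
... | yes refl with ρ s m ≟ n
...   | yes _ = τ (s , m)
...   | no _  = patch σ τ ρ xs (s , n)

patch-image : ∀ σ τ {ρ} → Injective ρ → ∀ xs {x} → x ∈ xs → patch σ τ ρ xs (renV ρ x) ≡ τ x
patch-image σ τ {ρ} ρ-inj ((s' , m') ∷ xs) {s , m} x∈ with s' ≟S s | x∈
... | no s'≢s | here eq = ⊥-elim (s'≢s (sym (cong proj₁ eq)))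
... | no _    | there x∈′ = patch-image σ τ ρ-inj xs x∈′
... | yes refl | x∈′ with ρ s m' ≟ ρ s m | x∈′
...   | yes eq | _ = cong (λ j → τ (s , j)) (ρ-inj s m' m eq)
...   | no neq | here eq = ⊥-elim (neq (cong (ρ s) (sym (cong proj₂ eq))))
...   | no _   | there x∈″ = patch-image σ τ ρ-inj xs x∈″

patch-outside : ∀ σ τ ρ xs {y} → y ∉ map (renV ρ) xs → patch σ τ ρ xs y ≡ σ y
patch-outside σ τ ρ [] _ = refl
patch-outside σ τ ρ ((s' , m') ∷ xs) {s , n} y∉ with s' ≟S s
... | no _ = patch-outside σ τ ρ xs (y∉ ∘ there)
... | yes refl with ρ s m' ≟ n
...   | yes eq = ⊥-elim (y∉ (here (cong (s ,_) (sym eq))))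
...   | no _   = patch-outside σ τ ρ xs (y∉ ∘ there)

shiftedUnion : Valuation → Valuation → ℕ → Valuation
shiftedUnion τ σ k (s , n) with k ≤? n
... | yes _ = σ (s , n ∸ k)
... | no _  = τ (s , n)

shiftedUnion-shift : ∀ τ σ k x → shiftedUnion τ σ k (renV (shift k) x) ≡ σ x
shiftedUnion-shift τ σ k (s , n) with k ≤? n + k
... | yes _ = cong (λ j → σ (s , j)) (m+n∸n≡m n k)
... | no k≰ = ⊥-elim (k≰ (m≤n+m k n))

shiftedUnion-below : ∀ τ σ k x → proj₂ x < k → shiftedUnion τ σ k x ≡ τ x
shiftedUnion-below τ σ k (s , n) n<k with k ≤? n
... | yes k≤n = ⊥-elim (<-irrefl refl (<-≤-trans n<k k≤n))
... | no _ = refl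

below-offset : ∀ D {x} → x ∈ hvars D ++ args (body D) → proj₂ x < offset D
below-offset D x∈ = s≤s (≤-foldr-⊔ proj₂ (hvars D ++ args (body D)) x∈)

unfolding-sound : ∀ {P D K σ} → K ∈ P → pred (hd K) ≡ pred (body D) → Sat σ (con (unfoldWith D K)) →
                  All (λ B → M P (inst σ B)) (bd (unfoldWith D K)) → M P (inst σ (body D))
unfolding-sound {P} {D} {K} {σ} K∈ K≡D sat bodyM =
  subst (λ q → M P (q , map (val σ) (args (body D)))) K≡D (rule K∈ satK bodyK headK)
  where
    ρ = shift (offset D)
    equations = eqArgs (args (body D)) (map (renV ρ) (args (hd K)))
    satK : Sat (σ ∘ᵣ ρ) (con K)
    satK = Sat-ren⁻ σ ρ (con K) (AllP.++⁻ʳ equations sat)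
    bodyK : All (λ B → M P (inst (σ ∘ᵣ ρ) B)) (bd K)
    bodyK = All.map (λ {B} → subst (M P) (inst-ren σ ρ B)) (AllP.map⁻ bodyM)
    headK : map (val (σ ∘ᵣ ρ)) (args (hd K)) ≋ map (val σ) (args (body D))
    headK = ≋.trans (≋.reflexive (sym (map-val-ren σ ρ (args (hd K)))))
                    (≋.sym (Sat-eqArgs⁻ σ (args (body D)) _ (AllP.++⁻ˡ equations sat)))

-- The unfolded clause is fired by τ on the variables of the definition and by
-- the valuation of K, shifted past them, on the renamed-apart variables of K.
unfolding-complete : ∀ D K τ σ → Sat σ (con K) → map (val σ) (args (hd K)) ≋ map (val τ) (args (body D)) →
  let σ' = shiftedUnion τ σ (offset D) in
  Agree σ' τ (hvars D ++ args (body D)) × Sat σ' (con (unfoldWith D K))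
unfolding-complete D K τ σ satK K≋D = on-definition , AllP.++⁺ equations satK′
  where
    k = offset D
    σ' = shiftedUnion τ σ k
    on-definition : Agree σ' τ (hvars D ++ args (body D))
    on-definition x∈ = shiftedUnion-below τ σ k _ (below-offset D x∈)
    on-K : ∀ x → (σ' ∘ᵣ shift k) x ≡ σ x
    on-K = shiftedUnion-shift τ σ k
    equations : Sat σ' (eqArgs (args (body D)) (map (renV (shift k)) (args (hd K))))
    equations = Sat-eqArgs⁺ σ' (args (body D)) _ (≋.trans (≋.reflexive (map-val-agree (args (body D)) (on-definition ∘ ∈.∈-++⁺ʳ (hvars D))))
                  (≋.trans (≋.sym K≋D) (≋.reflexive (sym (trans (map-val-ren σ' (shift k) (args (hd K))) (map-val-agree (args (hd K)) λ {x} _ → on-K x))))))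
    satK′ : Sat σ' (map (renAC (shift k)) (con K))
    satK′ = Sat-ren⁺ σ' (shift k) (con K) (Sat-agree (con K) (λ {x} _ → sym (on-K x)) satK)

module Correctness (P : Program) {Δ : Defs} (wf : WellFormed Δ) {P'} (out : Output P Δ P') where

  folded-args⊆ : ∀ {H c L Bs As} → FoldBody Δ H c L Bs As → ∀ {A} → A ∈ As → args A ⊆ concatMap args Bs
  folded-args⊆ ((D , D∈ , ρ , _ , refl , _ , refl) ∷ _) (here refl) x∈ with y , y∈ , refl ← ∈.∈-map⁻ (renV ρ) x∈ =
    ∈.∈-++⁺ˡ (∈.∈-map⁺ (renV ρ) (head⊆body wf D∈ y∈))
  folded-args⊆ ((D , _ , ρ , _ , refl , _ , refl) ∷ R↦As) (there A∈) x∈ =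
    ∈.∈-++⁺ʳ (map (renV ρ) (args (body D))) (folded-args⊆ R↦As A∈ x∈)

  Sound : GAtom → Set
  Sound g = (proj₁ g ≡ unsafeP → M P g) ×
            (∀ {D} → D ∈ Δ → newp D ≡ proj₁ g →
               ∃ λ τ → map (val τ) (hvars D) ≋ proj₂ g × M P (inst τ (body D)))

  -- Linking variables keep their values and the others take those of the
  -- witness τ; this is why a definition need only export linking variables.
  fold-atom-sound : ∀ H c L R {D} → D ∈ Δ → ∀ {ρ} → Injective ρ →
    linkvars H c L (renA ρ (body D)) R ⊆ map (renV ρ) (hvars D) → ∀ σ →
    Sound (inst σ (atom (newp D) (map (renV ρ) (hvars D)))) →
    ∃ λ σ' → Agree σ σ' (contextVars H c (L ++ R)) × M P (inst σ' (renA ρ (body D)))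
  fold-atom-sound H c L R {D} D∈ {ρ} ρ-inj V⊆head σ (_ , unfold)
    with τ , τ≋σ , Mτ ← unfold D∈ refl = σ' , σ≡σ' , M-resp-≋ Mτ τ≋σ'
    where
      xs = args (body D)
      V = linkvars H c L (renA ρ (body D)) R
      σ' : Valuation
      σ' y with mem? _≟V_ y V
      ... | yes _ = σ y
      ... | no _  = patch σ τ ρ xs y
      σ≡σ' : Agree σ σ' (contextVars H c (L ++ R))
      σ≡σ' {y} y∈ with mem? _≟V_ y V
      ... | yes _ = refl
      ... | no y∉V = sym (patch-outside σ τ ρ xs λ y∈ρxs →
                      y∉V (∈.∈-deduplicate⁺ _≟V_ (∈.∈-filter⁺ (λ x → mem? _≟V_ x (contextVars H c (L ++ R))) y∈ρxs y∈)))
      on-head : map (val τ) (hvars D) ≋ map (val (σ ∘ᵣ ρ)) (hvars D)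
      on-head = ≋.trans τ≋σ (≋.reflexive (map-val-ren σ ρ (hvars D)))
      pointwise : ∀ {x} → x ∈ xs → GEq (val τ x) (val (σ' ∘ᵣ ρ) x)
      pointwise {s , m} x∈ with mem? _≟V_ (s , ρ s m) V
      ... | yes ρx∈V with h , h∈ , ρh≡ρx ← ∈.∈-map⁻ (renV ρ) (V⊆head ρx∈V) =
        ≋-map⁻ (val τ) (val (σ ∘ᵣ ρ)) (hvars D) on-head (subst (_∈ hvars D) (sym (renV-injective ρ-inj ρh≡ρx)) h∈)
      ... | no _ = subst (λ v → GEq (s , τ (s , m)) (s , v)) (sym (patch-image σ τ ρ-inj xs x∈)) (IsEquivalence.refl GEq-isEquivalence)
      τ≋σ' : map (val τ) xs ≋ proj₂ (inst σ' (renA ρ (body D)))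
      τ≋σ' = ≋.trans (≋-map (val τ) (val (σ' ∘ᵣ ρ)) xs pointwise) (≋.reflexive (sym (map-val-ren σ' ρ xs)))

  fold-body-sound : ∀ {H c L Bs As} → FoldBody Δ H c L Bs As → ∀ σ → All (λ A → Sound (inst σ A)) As →
    ∃ λ σ' → Agree σ σ' (contextVars H c L) × All (λ B → M P (inst σ' B)) Bs
  fold-body-sound [] σ [] = σ , (λ _ → refl) , []
  fold-body-sound {H} {c} {L} (_∷_ {R = R} (D , D∈ , ρ , ρ-inj , refl , V⊆head , refl) R↦As) σ (sound-A ∷ sound-As)
    with σ₁ , σ≡σ₁ , M-B ← fold-atom-sound H c L R D∈ ρ-inj V⊆head σ sound-A
    with σ₂ , σ₁≡σ₂ , M-R ← fold-body-sound R↦As σ₁ (tabulate λ A∈ →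
           subst Sound (inst-agree _ (σ≡σ₁ ∘ contextVars⁺ H c {L ++ R} ∘ concatMap⁺ args (xs⊆ys++xs R L) ∘ folded-args⊆ R↦As A∈))
                 (lookup sound-As A∈))
    = σ₂ , σ≡σ₂ , subst (M P) (inst-agree B (σ₁≡σ₂ ∘ contextVars⁺ H c {L ++ [ B ]} ∘ ∈.∈-concatMap⁺ args ∘ lose (∈.∈-++⁺ʳ L (here refl)))) M-B ∷ M-R
    where
      B = renA ρ (body D)
      σ≡σ₂ : Agree σ σ₂ (contextVars H c L)
      σ≡σ₂ x∈ = trans (σ≡σ₁ (contextVars-mono H c (xs⊆xs++ys L R) x∈)) (σ₁≡σ₂ (contextVars-mono H c (xs⊆xs++ys L [ B ]) x∈))

  sound-clause : ∀ {C C' σ vs} → C ∈ Cls P Δ → FoldedFrom Δ C C' → Sat σ (con C') →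
    All (λ A → Sound (inst σ A)) (bd C') → map (val σ) (args (hd C')) ≋ vs → Sound (pred (hd C') , vs)
  sound-clause {C} {clause _ _ _} {σ} {vs} C∈ (refl , refl , body↦) sat sound-body head≋
    with σ' , σ≡σ' , M-body ← fold-body-sound body↦ σ sound-body
    with ∈Cls⁻ P Δ C∈
  ... | unsafe C∈P C-unsafe =
    (λ _ → rule C∈P (Sat-agree (con C) (σ≡σ' ∘ ∈.∈-++⁺ʳ (args (hd C)) ∘ ∈.∈-++⁺ˡ) sat) M-body head≋′) ,
    (λ D∈ D≡C → ⊥-elim (newp≢unsafe wf D∈ (trans D≡C C-unsafe)))
    where head≋′ = ≋.trans (≋.reflexive (sym (map-val-agree (args (hd C)) (σ≡σ' ∘ ∈.∈-++⁺ˡ)))) head≋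
  ... | unfolded {D} {K} D∈ K∈ K≡D = (λ D-unsafe → ⊥-elim (newp≢unsafe wf D∈ D-unsafe)) , witness
    where
      witness : ∀ {D'} → D' ∈ Δ → newp D' ≡ newp D → ∃ λ τ → map (val τ) (hvars D') ≋ vs × M P (inst τ (body D'))
      witness D'∈ D'≡D with refl ← newp-injective wf D'∈ D∈ D'≡D =
        σ' , ≋.trans (≋.reflexive (sym (map-val-agree (hvars D) (σ≡σ' ∘ ∈.∈-++⁺ˡ)))) head≋ ,
        unfolding-sound {D = D} {K} K∈ K≡D (Sat-agree (con C) (σ≡σ' ∘ ∈.∈-++⁺ʳ (hvars D) ∘ ∈.∈-++⁺ˡ) sat) M-body

  sound : ∀ {g} → M P' g → Sound g
  sound-all : ∀ {σ As} → All (λ A → M P' (inst σ A)) As → All (λ A → Sound (inst σ A)) As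
  sound (rule C'∈ sat body head) with C , C∈ , C↦C' ← Pointwise-∈ʳ out C'∈ = sound-clause C∈ C↦C' sat (sound-all body) head
  sound-all [] = []
  sound-all (M-A ∷ M-As) = sound M-A ∷ sound-all M-As

  Complete : GAtom → Set
  Complete g = ∀ {D} → D ∈ Δ → ∀ τ → pred (body D) ≡ proj₁ g → map (val τ) (args (body D)) ≋ proj₂ g →
               M P' (inst τ (atom (newp D) (hvars D)))

  fold-body-complete : ∀ {H c L Bs As} → FoldBody Δ H c L Bs As → ∀ σ → All (λ B → Complete (inst σ B)) Bs →
                       All (λ A → M P' (inst σ A)) As
  fold-body-complete [] σ [] = []
  fold-body-complete ((D , D∈ , ρ , _ , refl , _ , refl) ∷ R↦As) σ (complete-B ∷ complete-R) =
    subst (M P') (sym (inst-ren σ ρ (atom (newp D) (hvars D))))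
          (complete-B D∈ (σ ∘ᵣ ρ) refl (≋.reflexive (sym (map-val-ren σ ρ (args (body D)))))) ∷
    fold-body-complete R↦As σ complete-R

  complete-unfolded : ∀ {D K C' τ σ vs} → D ∈ Δ → FoldedFrom Δ (unfoldWith D K) C' → C' ∈ P' →
    Sat σ (con K) → All (λ B → Complete (inst σ B)) (bd K) → map (val σ) (args (hd K)) ≋ vs →
    map (val τ) (args (body D)) ≋ vs → M P' (inst τ (atom (newp D) (hvars D)))
  complete-unfolded {D} {K} {clause _ _ _} {τ} {σ} D∈ (refl , refl , body↦) C'∈ satK complete-K K≋ D≋
    with on-D , sat ← unfolding-complete D K τ σ satK (≋.trans K≋ (≋.sym D≋)) =
    rule C'∈ sat (fold-body-complete body↦ σ' complete-body) (≋.reflexive (map-val-agree (hvars D) (on-D ∘ ∈.∈-++⁺ˡ)))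
    where
      k = offset D
      σ' = shiftedUnion τ σ k
      complete-body : All (λ B → Complete (inst σ' B)) (map (renA (shift k)) (bd K))
      complete-body = AllP.map⁺ (All.map (λ {B} → subst Complete
                        (sym (trans (inst-ren σ' (shift k) B) (inst-agree B λ {x} _ → shiftedUnion-shift τ σ k x)))) complete-K)

  complete : ∀ {g} → M P g → Complete g
  complete-all : ∀ {σ Bs} → All (λ B → M P (inst σ B)) Bs → All (λ B → Complete (inst σ B)) Bs
  complete (rule {K} K∈ satK body head) D∈ τ D≡K D≋
    with C' , C'∈ , ↦C' ← Pointwise-∈ˡ out (∈Cls⁺-unfolded P Δ D∈ K∈ (sym D≡K)) =
    complete-unfolded {K = K} D∈ ↦C' C'∈ satK (complete-all body) head D≋
  complete-all [] = []
  complete-all (M-B ∷ M-Bs) = complete M-B ∷ complete-all M-Bs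

  complete-unsafe : ∀ {g} → M P g → proj₁ g ≡ unsafeP → M P' g
  complete-unsafe (rule C∈ sat body head) C-unsafe
    with C' , C'∈ , (refl , refl , body↦) ← Pointwise-∈ˡ out (∈Cls⁺-unsafe P Δ C∈ C-unsafe) =
    rule C'∈ sat (fold-body-complete body↦ _ (complete-all body)) head

  unsafe-preserved : M P unsafeG ⇔ M P' unsafeG
  unsafe-preserved = mk⇔ (λ M-unsafe → complete-unsafe M-unsafe refl) (λ M-unsafe → proj₁ (sound M-unsafe) refl)

theorem1 : (P : Program) → UnsafeNullary P →
    Acc (λ Δ' Δ → Step P Δ Δ') []
    × (∀ Δ → Reach P Δ → Final P Δ ⊎ ∃ (Step P Δ))
    × (∀ Δ → Reach P Δ → Final P Δ →
         ∃ (Output P Δ) × (∀ P' → Output P Δ P' → (M P unsafeG ⇔ M P' unsafeG)))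
theorem1 P _ =
  termination P ,
  progress P ,
  λ Δ reach final → foldClauses Δ (Cls P Δ) final ,
                    λ P' out → Correctness.unsafe-preserved P (reach-wellFormed reach) out
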